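{- Let $G(V,E)$ be a $k$-uniform hypergraph and let $\{I_1,I_2,\dots,I_u\}$ be a partition of $V$ into independent sets. Then $G$ has a bicoloring cover of size $\lceil \log_2 u\rceil$.
   Context: A set $I\subseteq V$ is independent if no hyperedge $e\in E$ satisfies $e\subseteq I$. A bicoloring is a map $X:V\to\{0,1\}$; a bicoloring cover of $G$ is a set of bicolorings such that every hyperedge is non-monochromatic under at least one of them. -}

module Defs where

open import Data.Nat using (ℕ)
open import Data.Fin using (Fin)
open import Data.Fin.Subset using (Subset; _∈_; _⊆_; ∣_∣; Nonempty)
open import Data.Bool using (Bool)
open import Data.Product using (∃; ∃-syntax; _×_)
open import Relation.Nullary using (¬_)
open import Relation.Binary.PropositionalEquality using (_≡_; _≢_)

Hypergraph : ℕ → ℕ → Set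
Hypergraph n m = Fin m → Subset n

Uniform : ∀ {n m} → ℕ → Hypergraph n m → Set
Uniform k E = ∀ j → ∣ E j ∣ ≡ k

Independent : ∀ {n m} → Hypergraph n m → Subset n → Set
Independent E I = ∀ j → ¬ (E j ⊆ I)

IsPartition : ∀ {n u} → (Fin u → Subset n) → Set
IsPartition {n} {u} I =
  (∀ i → Nonempty (I i)) ×
  (∀ (i i' : Fin u) (v : Fin n) → v ∈ I i → v ∈ I i' → i ≡ i') ×
  (∀ (v : Fin n) → ∃[ i ] (v ∈ I i))

Bicoloring : ℕ → Set
Bicoloring n = Fin n → Bool

NonMonochromatic : ∀ {n} → Bicoloring n → Subset n → Set
NonMonochromatic X e = ∃[ v ] ∃[ w ] (v ∈ e × w ∈ e × X v ≢ X w)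

IsBicoloringCover : ∀ {n m t} → Hypergraph n m → (Fin t → Bicoloring n) → Set
IsBicoloringCover E C = ∀ j → ∃[ s ] NonMonochromatic (C s) (E j)

module Submission where

-- Number the blocks of the partition 0, …, u-1 and let t = ⌈log₂ u⌉.
-- The s-th bicoloring (s < t) colours a vertex by the s-th binary digit of the
-- index of its block.  Indices below u are below 2^t, so two distinct indices
-- differ in one of their first t digits; a hyperedge is nonempty and, since
-- blocks are independent, not contained in one block, hence it has two
-- vertices in different blocks, which some digit colouring separates.  The
-- colourings are pairwise distinct because 2^s < u is a block index whose only
-- nonzero digit among the first t is the s-th.

open import Defs
open import Data.Nat using (ℕ; _≤_)
open import Data.Nat.Logarithm using (⌈log₂_⌉)
open import Data.Fin using (Fin)
open import Data.Fin.Subset using (Subset)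
open import Data.Product using (∃-syntax; _×_)
open import Function.Definitions using (Injective)
open import Relation.Binary.PropositionalEquality using (_≡_)

open import Data.Nat using (zero; suc; _+_; _*_; _^_; _<_; ⌊_/2⌋; ⌈_/2⌉; z≤n; s≤s; z<s; s<s)
open import Data.Nat.Properties
open import Data.Nat.Logarithm using (⌈log₂⌉-mono-≤; ⌈log₂2^n⌉≡n)
open import Data.Nat.Logarithm.Core using (⌈log2⌉)
open import Induction.WellFounded using (Acc; acc)
open import Data.Fin using (toℕ; fromℕ<)
open import Data.Fin.Properties using (toℕ-injective; toℕ<n; toℕ-fromℕ<; ¬∀⟶∃¬)
open import Data.Fin.Subset using (_∈_; _∉_; _⊆_; ∣_∣; Nonempty)
open import Data.Fin.Subset.Properties using (_∈?_; nonempty?; Empty-unique; ∣⊥∣≡0)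
open import Data.Bool using (Bool; true; false) renaming (_≟_ to _≟ᵇ_)
open import Data.Product using (_,_; proj₁; proj₂)
open import Relation.Nullary using (¬_; yes; no; contradiction)
open import Relation.Nullary.Decidable using (_→-dec_)
open import Relation.Binary.PropositionalEquality using (refl; sym; trans; cong; cong-app; subst; _≢_; module ≡-Reasoning)

odd : ℕ → Bool
odd zero          = false
odd (suc zero)    = true
odd (suc (suc n)) = odd n

bit : ℕ → ℕ → Bool
bit zero    i = odd i
bit (suc s) i = bit s ⌊ i /2⌋

odd-half-injective : ∀ a b → odd a ≡ odd b → ⌊ a /2⌋ ≡ ⌊ b /2⌋ → a ≡ b
odd-half-injective zero          zero          _ _  = refl
odd-half-injective (suc zero)    (suc zero)    _ _  = refl
odd-half-injective (suc (suc a)) (suc (suc b)) o h  =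
  cong (λ x → suc (suc x)) (odd-half-injective a b o (suc-injective h))
odd-half-injective zero          (suc zero)    () _
odd-half-injective (suc zero)    zero          () _
odd-half-injective zero          (suc (suc b)) _ ()
odd-half-injective (suc zero)    (suc (suc b)) _ ()
odd-half-injective (suc (suc a)) zero          _ ()
odd-half-injective (suc (suc a)) (suc zero)    _ ()

half-< : ∀ a m → a < 2 * m → ⌊ a /2⌋ < m
half-< zero          (suc m) _ = z<s
half-< (suc zero)    (suc m) _ = z<s
half-< (suc (suc a)) (suc m) p =
  s<s (half-< a m (≤-pred (subst (suc (suc a) ≤_) (+-suc m (m + 0)) (≤-pred p))))

bits-injective : ∀ t a b → a < 2 ^ t → b < 2 ^ t →
                 (∀ (s : Fin t) → bit (toℕ s) a ≡ bit (toℕ s) b) → a ≡ b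
bits-injective zero    zero    zero    _          _          _ = refl
bits-injective zero    (suc a) _       (s≤s ())   _          _
bits-injective zero    zero    (suc b) _          (s≤s ())   _
bits-injective (suc t) a    b    a< b< same =
  odd-half-injective a b (same Data.Fin.zero)
    (bits-injective t ⌊ a /2⌋ ⌊ b /2⌋ (half-< a (2 ^ t) a<) (half-< b (2 ^ t) b<)
                    (λ s → same (Data.Fin.suc s)))

odd-n+n : ∀ n → odd (n + n) ≡ false
odd-n+n zero    = refl
odd-n+n (suc n) = trans (cong (λ x → odd (suc x)) (+-suc n n)) (odd-n+n n)

odd-double : ∀ n → odd (2 * n) ≡ false
odd-double n = trans (cong (λ x → odd (n + x)) (+-identityʳ n)) (odd-n+n n)

bit-double : ∀ s n → bit (suc s) (2 * n) ≡ bit s n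
bit-double s n = cong (bit s) (begin
  ⌊ n + (n + 0) /2⌋ ≡⟨ cong (λ x → ⌊ n + x /2⌋) (+-identityʳ n) ⟩
  ⌊ n + n /2⌋       ≡⟨ sym (n≡⌊n+n/2⌋ n) ⟩
  n                 ∎)
  where open ≡-Reasoning

bit-zero : ∀ s → bit s 0 ≡ false
bit-zero zero    = refl
bit-zero (suc s) = bit-zero s

bit-power-self : ∀ s → bit s (2 ^ s) ≡ true
bit-power-self zero    = refl
bit-power-self (suc s) = trans (bit-double s (2 ^ s)) (bit-power-self s)

bit-power-other : ∀ s s' → s ≢ s' → bit s' (2 ^ s) ≡ false
bit-power-other zero    zero     s≢s' = contradiction refl s≢s'
bit-power-other zero    (suc s') _    = bit-zero s'
bit-power-other (suc s) zero     _    = odd-double (2 ^ s)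
bit-power-other (suc s) (suc s') s≢s' =
  trans (bit-double s' (2 ^ s)) (bit-power-other s s' (λ eq → s≢s' (cong suc eq)))

-- n ≤ 2^⌈log₂ n⌉, by the recursion defining ⌈log₂_⌉ (through ⌈ n/2 ⌉).
≤-2^⌈log2⌉ : ∀ n (ac : Acc _<_ n) → n ≤ 2 ^ ⌈log2⌉ n ac
≤-2^⌈log2⌉ zero          _        = z≤n
≤-2^⌈log2⌉ (suc zero)    _        = s≤s z≤n
≤-2^⌈log2⌉ (suc (suc n)) (acc rs) = begin
  suc (suc n)       ≤⟨ s≤s (s≤s n≤c+c) ⟩
  suc (suc (c + c)) ≡⟨ cong suc (sym (+-suc c c)) ⟩
  suc c + suc c     ≤⟨ +-mono-≤ ih (≤-trans ih (≤-reflexive (sym (+-identityʳ _)))) ⟩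
  2 * 2 ^ L         ∎
  where
  open ≤-Reasoning
  c = ⌈ n /2⌉
  L = ⌈log2⌉ (suc c) _
  ih : suc c ≤ 2 ^ L
  ih = ≤-2^⌈log2⌉ (suc c) _
  n≤c+c : n ≤ c + c
  n≤c+c = subst (_≤ c + c) (⌊n/2⌋+⌈n/2⌉≡n n) (+-monoˡ-≤ c (⌊n/2⌋≤⌈n/2⌉ n))

≤-2^⌈log₂⌉ : ∀ n → n ≤ 2 ^ ⌈log₂ n ⌉
≤-2^⌈log₂⌉ n = ≤-2^⌈log2⌉ n _

2^<n : ∀ n s → s < ⌈log₂ n ⌉ → 2 ^ s < n
2^<n n s s<log = ≰⇒> λ n≤2^s →
  <⇒≱ s<log (≤-trans (⌈log₂⌉-mono-≤ n≤2^s) (≤-reflexive (⌈log₂2^n⌉≡n s)))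

digit : ∀ {u} → Fin ⌈log₂ u ⌉ → Fin u → Bool
digit s i = bit (toℕ s) (toℕ i)

digits-separate : ∀ {u} (i i' : Fin u) → i ≢ i' → ∃[ s ] digit s i ≢ digit s i'
digits-separate {u} i i' i≢i' =
  ¬∀⟶∃¬ ⌈log₂ u ⌉ (λ s → digit s i ≡ digit s i') (λ s → digit s i ≟ᵇ digit s i')
    (λ same → i≢i' (toℕ-injective
      (bits-injective ⌈log₂ u ⌉ (toℕ i) (toℕ i') (below i) (below i') same)))
  where
  below : ∀ (j : Fin u) → toℕ j < 2 ^ ⌈log₂ u ⌉
  below j = <-≤-trans (toℕ<n j) (≤-2^⌈log₂⌉ u)

power : ∀ {u} → Fin ⌈log₂ u ⌉ → Fin u
power {u} s = fromℕ< (2^<n u (toℕ s) (toℕ<n s))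

-- The digit functions are pairwise distinct: digit s' sees 2^s as 1 only when s' = s.
digit-power-injective : ∀ {u} (s s' : Fin ⌈log₂ u ⌉) →
                        digit s (power {u} s) ≡ digit s' (power {u} s) → s ≡ s'
digit-power-injective {u} s s' eq with toℕ s ≟ toℕ s'
... | yes same = toℕ-injective same
... | no differ = contradiction (begin
  true                          ≡⟨ sym (bit-power-self (toℕ s)) ⟩
  bit (toℕ s)  (2 ^ toℕ s)      ≡⟨ subst (λ x → bit (toℕ s) x ≡ bit (toℕ s') x) toℕ-power eq ⟩
  bit (toℕ s') (2 ^ toℕ s)      ≡⟨ bit-power-other (toℕ s) (toℕ s') differ ⟩
  false                         ∎) λ ()
  where
  open ≡-Reasoning
  toℕ-power : toℕ (power {u} s) ≡ 2 ^ toℕ s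
  toℕ-power = toℕ-fromℕ< _

⊈-witness : ∀ {n} (p q : Subset n) → ¬ (p ⊆ q) → ∃[ x ] (x ∈ p × x ∉ q)
⊈-witness {n} p q p⊈q with ¬∀⟶∃¬ n (λ x → x ∈ p → x ∈ q) (λ x → (x ∈? p) →-dec (x ∈? q)) (λ f → p⊈q (f _))
... | x , ¬[x∈p→x∈q] with x ∈? p
...   | yes x∈p = x , x∈p , λ x∈q → ¬[x∈p→x∈q] (λ _ → x∈q)
...   | no  x∉p = contradiction (λ x∈p → contradiction x∈p x∉p) ¬[x∈p→x∈q]

size-nonempty : ∀ {n} (e : Subset n) → 1 ≤ ∣ e ∣ → Nonempty e
size-nonempty {n} e 1≤∣e∣ with nonempty? e
... | yes ne = ne
... | no empty = contradiction (subst (1 ≤_) ∣e∣≡0 1≤∣e∣) λ ()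
  where
  ∣e∣≡0 : ∣ e ∣ ≡ 0
  ∣e∣≡0 = trans (cong ∣_∣ (Empty-unique empty)) (∣⊥∣≡0 n)

module Blocks {n u} (I : Fin u → Subset n) (partition : IsPartition I) where

  block : Fin n → Fin u
  block v = proj₁ (proj₂ (proj₂ partition) v)

  block-∈ : ∀ v → v ∈ I (block v)
  block-∈ v = proj₂ (proj₂ (proj₂ partition) v)

  block-unique : ∀ {v i} → v ∈ I i → block v ≡ i
  block-unique {v} {i} v∈Ii = proj₁ (proj₂ partition) (block v) i v (block-∈ v) v∈Ii

  block-surjective : ∀ i → ∃[ v ] block v ≡ i
  block-surjective i = let (v , v∈Ii) = proj₁ partition i in v , block-unique v∈Ii

  split : ∀ (e : Subset n) → Nonempty e → (∀ i → ¬ (e ⊆ I i)) →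
          ∃[ v ] ∃[ w ] (v ∈ e × w ∈ e × block v ≢ block w)
  split e (v , v∈e) notInBlock =
    let (w , w∈e , w∉Iv) = ⊈-witness e (I (block v)) (notInBlock (block v))
    in v , w , v∈e , w∈e , λ same → w∉Iv (subst (λ i → w ∈ I i) (sym same) (block-∈ w))

lemma3 : (n m k u : ℕ) → (E : Hypergraph n m) → 1 ≤ k → Uniform k E →
         (I : Fin u → Subset n) → IsPartition I → (∀ i → Independent E (I i)) →
         ∃[ C ] (Injective _≡_ _≡_ C × IsBicoloringCover {t = ⌈log₂ u ⌉} E C)
lemma3 n m k u E 1≤k uniform I partition independent = C , injective , cover
  where
  open Blocks I partition

  C : Fin ⌈log₂ u ⌉ → Bicoloring n
  C s v = digit s (block v)

  injective : Injective _≡_ _≡_ C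
  injective {s} {s'} eq =
    let (v , block-v≡2^s) = block-surjective (power s)
    in digit-power-injective s s'
         (subst (λ i → digit s i ≡ digit s' i) block-v≡2^s (cong-app eq v))

  cover : IsBicoloringCover E C
  cover j =
    let e-nonempty = size-nonempty (E j) (subst (1 ≤_) (sym (uniform j)) 1≤k)
        (v , w , v∈e , w∈e , differ) = split (E j) e-nonempty (λ i → independent i j)
        (s , digit≢) = digits-separate (block v) (block w) differ
    in s , v , w , v∈e , w∈e , digit≢
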